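{- Let $n\in\mathbb{N}$, $d\ge0$ an integer, and $k\in[n+1]$. There is a bijection \[\rho:\{\mathbf{x}\in\mathrm{DPF}^\uparrow_{n,n,d}:x_n\le k\}\to\{\mathbf{y}\in\mathrm{PF}^\uparrow_{n+d,n+d}:y_{n+d}\le k-d\}\] such that $D(\mathbf{x})=F(\rho(\mathbf{x}))$ for every $\mathbf{x}$ in the domain.
   Context: For $\mathbf{x}\in[n+1]^n$: cars $1,\ldots,n$ arrive in order at an infinitely long street with spots $1,2,3,\ldots$, car $i$ parking in the first empty spot numbered $\ge x_i$; the defect is the number of cars parking in a spot numbered greater than $n$. $\mathrm{DPF}^\uparrow_{n,n,d}$ is the set of nondecreasing $\mathbf{x}\in[n+1]^n$ with defect $d$. $\mathrm{PF}^\uparrow_{N,N}$ is the set of nondecreasing $\mathbf{y}=(y_1,\ldots,y_N)$ of positive integers with $y_j\le j$ for all $j$ (nondecreasing parking functions). For $\mathbf{x}\in\mathrm{DPF}^\uparrow_{n,n,d}$ let $\delta(\mathbf{x})_i=x_i-i$; the decrement set $D(\mathbf{x})$ is the set of $i\in[n]$ with $\delta(\mathbf{x})_i\ge0$ such that no $j<i$ has $\delta(\mathbf{x})_j>0$. For $\mathbf{y}\in\mathrm{PF}^\uparrow_{N,N}$ the fixed set is $F(\mathbf{y})=\{j: y_j=j\}$. -}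

module Defs where

open import Data.Nat using (ℕ; zero; suc; _+_; _≤_; _<_; _<ᵇ_)
open import Data.Nat.Properties using (_≟_)
open import Data.Bool using (Bool; true; false; if_then_else_)
open import Data.List using (List; []; _∷_; length; filterᵇ)
open import Data.List.Membership.DecPropositional _≟_ using (_∈?_)
open import Data.Vec using (Vec; []; _∷_; lookup; toList)
open import Data.Vec.Relation.Unary.All using (All)
open import Data.Fin using (Fin; toℕ)
open import Data.Product using (Σ; _×_)
open import Data.Unit using (⊤)
open import Relation.Binary.PropositionalEquality using (_≡_)
open import Relation.Nullary using (yes; no)
open import Relation.Nullary.Decidable using (⌊_⌋)

-- first spot ≥ a not in the occupied list; fuel = (#occupied + 1) suffices
firstFreeFuel : ℕ → List ℕ → ℕ → ℕ
firstFreeFuel zero    occ a = a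
firstFreeFuel (suc f) occ a with a ∈? occ
... | yes _ = firstFreeFuel f occ (suc a)
... | no  _ = a

firstFree : List ℕ → ℕ → ℕ
firstFree occ a = firstFreeFuel (suc (length occ)) occ a

parkFrom : List ℕ → List ℕ → List ℕ
parkFrom occ []       = occ
parkFrom occ (a ∷ as) = parkFrom (firstFree occ a ∷ occ) as

parkedSpots : List ℕ → List ℕ
parkedSpots prefs = parkFrom [] prefs

defect : (n : ℕ) → List ℕ → ℕ
defect n prefs = length (filterᵇ (λ s → n <ᵇ s) (parkedSpots prefs))

-- Nondecreasing vectors and "last entry ≤ k" (vacuous for empty vectors)

Nondecreasing : {m : ℕ} → Vec ℕ m → Set
Nondecreasing []           = ⊤
Nondecreasing (x ∷ [])     = ⊤
Nondecreasing (x ∷ y ∷ v)  = x ≤ y × Nondecreasing (y ∷ v)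

LastLe : {m : ℕ} → Vec ℕ m → ℕ → Set
LastLe []          k = ⊤
LastLe (x ∷ [])    k = x ≤ k
LastLe (x ∷ y ∷ v) k = LastLe (y ∷ v) k

IsDPFup : (n d : ℕ) → Vec ℕ n → Set
IsDPFup n d x =
  All (λ a → 1 ≤ a × a ≤ suc n) x × Nondecreasing x × defect n (toList x) ≡ d

PFBound : {m : ℕ} → ℕ → Vec ℕ m → Set
PFBound j []      = ⊤
PFBound j (y ∷ v) = (1 ≤ y × y ≤ j) × PFBound (suc j) v

IsPFup : (N : ℕ) → Vec ℕ N → Set
IsPFup N y = Nondecreasing y × PFBound 1 y

-- Decrement set and fixed set, as predicates on 1-based positions i ∈ ℕ.
-- Position p : Fin n corresponds to index i = toℕ p + 1.
-- δ(x)_i = x_i - i ≥ 0  ⟺  i ≤ x_i ;  δ(x)_j > 0 fails ⟺ x_j ≤ j.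

InD : {n : ℕ} → Vec ℕ n → ℕ → Set
InD {n} x i = Σ (Fin n) λ p →
  (suc (toℕ p) ≡ i) × (i ≤ lookup x p) ×
  ((q : Fin n) → toℕ q < toℕ p → lookup x q ≤ suc (toℕ q))

InF : {N : ℕ} → Vec ℕ N → ℕ → Set
InF {N} y j = Σ (Fin N) λ p → (suc (toℕ p) ≡ j) × (lookup y p ≡ j)

-- "last entry ≤ c" with an integer bound c (used for y_{n+d} ≤ k - d)
open import Data.Integer using (ℤ; +_) renaming (_≤_ to _≤ℤ_)

LastLeℤ : {m : ℕ} → Vec ℕ m → ℤ → Set
LastLeℤ []          c = ⊤
LastLeℤ (x ∷ [])    c = + x ≤ℤ c
LastLeℤ (x ∷ y ∷ v) c = LastLeℤ (y ∷ v) c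

-- For nondecreasing x ∈ [n+1]^n, car i parks in spot i + f_i, where
-- f_i = max(0, max_{j ≤ i} (x_j − j)) is the running excess, so the defect is f_n.
-- ρ(x) reads x from left to right: whenever the excess rises from f to f′ at step i it
-- first writes f′ − f copies of i, then it writes x_i − f_i.  Call j − y_j the depth of
-- the entry y_j.  After f insertions every entry written has depth ≥ f, and an inserted
-- entry has depth exactly f, so y determines the insertions (the one raising the excess
-- past f is the last entry of depth f): ρ is a bijection onto the nondecreasing parking
-- functions with last entry ≤ k − d.  Up to the first insertion y agrees with x, the
-- first inserted entry is the fixed point i = min {i : x_i > i}, and all later entries
-- lie strictly below the diagonal; hence D(x) = F(ρ(x)).

{-# OPTIONS --safe #-}
module Submission where

open import Defs
open import Data.Nat using (ℕ; zero; suc; _+_; _∸_; _⊔_; _≤_; _<_; z≤n; s≤s; z<s; _<ᵇ_)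
open import Data.Nat.Properties
open import Data.Bool using (true; false; T)
open import Data.Empty using (⊥; ⊥-elim)
open import Data.Fin using (Fin; zero; suc; toℕ)
open import Data.Integer using (ℤ; +_; _-_; -_; +≤+) renaming (_≤_ to _≤ℤ_)
import Data.Integer.Properties as ℤ
open import Data.List using (List; []; _∷_; length; filterᵇ)
open import Data.List.Membership.DecPropositional _≟_ using (_∈_; _∈?_)
open import Data.List.Relation.Unary.Any using (here; there)
import Data.List.Relation.Unary.All as List
open import Data.Vec using (Vec; []; _∷_; toList; lookup)
open import Data.Vec.Relation.Unary.All using (All; []; _∷_)
import Data.Vec.Relation.Unary.All as All
open import Data.Product using (Σ; ∃-syntax; _×_; _,_; proj₁; proj₂)
open import Data.Sum using (_⊎_; inj₁; inj₂)
open import Data.Unit using (⊤; tt)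
open import Function.Base using (_∘_)
open import Function.Bundles using (_⤖_; _⇔_; Bijection; Equivalence; mk⤖; mk⇔)
import Function.Properties.Equivalence as ⇔
open import Relation.Binary.PropositionalEquality
open import Relation.Nullary using (¬_; Dec; yes; no; contradiction)
open import Relation.Nullary.Decidable using (_×-dec_)
open import Relation.Nullary.Irrelevant using (Irrelevant)

private
  variable
    a b c d f h i j k lo m m′ n p t v w z : ℕ
    occ : List ℕ
    xs xs′ : Vec ℕ m
    ys : Vec ℕ m′
    c′ : ℤ
    P Q : ℕ → ℕ → Set

NondecreasingFrom : ℕ → Vec ℕ m → Set
NondecreasingFrom b []       = ⊤
NondecreasingFrom b (x ∷ xs) = b ≤ x × NondecreasingFrom x xs

lastOr : ℕ → Vec ℕ m → ℕ
lastOr z []       = z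
lastOr z (x ∷ xs) = lastOr x xs

Nondecreasing⇒From : (xs : Vec ℕ m) → All (b ≤_) xs → Nondecreasing xs → NondecreasingFrom b xs
Nondecreasing⇒From []       _         _      = tt
Nondecreasing⇒From (x ∷ xs) (b≤x ∷ _) sorted = b≤x , tail xs sorted
  where
  tail : (xs : Vec ℕ m) → Nondecreasing (a ∷ xs) → NondecreasingFrom a xs
  tail []       _              = tt
  tail (y ∷ xs) (x≤y , sorted) = x≤y , tail xs sorted

From⇒Nondecreasing : (xs : Vec ℕ m) → NondecreasingFrom b xs → Nondecreasing xs
From⇒Nondecreasing []           _                  = tt
From⇒Nondecreasing (x ∷ [])     _                  = tt
From⇒Nondecreasing (x ∷ y ∷ xs) (_ , x≤y , sorted) =
  x≤y , From⇒Nondecreasing (y ∷ xs) (x≤y , sorted)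

NondecreasingFrom⇒All≤ : (xs : Vec ℕ m) → NondecreasingFrom b xs → LastLe xs k → All (_≤ k) xs
NondecreasingFrom⇒All≤ []           _                  _   = []
NondecreasingFrom⇒All≤ (x ∷ [])     _                  x≤k = x≤k ∷ []
NondecreasingFrom⇒All≤ (x ∷ y ∷ xs) (_ , x≤y , sorted) ≤k  =
  let rest = NondecreasingFrom⇒All≤ (y ∷ xs) (x≤y , sorted) ≤k
  in  ≤-trans x≤y (All.head rest) ∷ rest

LastLe⇒lastOr≤ : (xs : Vec ℕ m) → z ≤ k → LastLe xs k → lastOr z xs ≤ k
LastLe⇒lastOr≤ []           z≤k _  = z≤k
LastLe⇒lastOr≤ (x ∷ [])     _   ≤k = ≤k
LastLe⇒lastOr≤ (x ∷ y ∷ xs) z≤k ≤k = LastLe⇒lastOr≤ (y ∷ xs) z≤k ≤k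

lastOr≤⇒LastLe : (xs : Vec ℕ m) → lastOr z xs ≤ k → LastLe xs k
lastOr≤⇒LastLe []           _  = tt
lastOr≤⇒LastLe (x ∷ [])     ≤k = ≤k
lastOr≤⇒LastLe (x ∷ y ∷ xs) ≤k = lastOr≤⇒LastLe {z = x} (y ∷ xs) ≤k

m+n≤o⇒+m≤+o-+n : ∀ m n o → m + n ≤ o → + m ≤ℤ + o - + n
m+n≤o⇒+m≤+o-+n m n o m+n≤o = subst (+ m ≤ℤ_) o-n≡o∸n (+≤+ (m+n≤o⇒m≤o∸n m m+n≤o))
  where
  o-n≡o∸n : + (o ∸ n) ≡ + o - + n
  o-n≡o∸n = sym (trans (ℤ.m-n≡m⊖n o n) (ℤ.⊖-≥ (m+n≤o⇒n≤o m m+n≤o)))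

+m≤+o-+n⇒m+n≤o : ∀ m n o → + m ≤ℤ + o - + n → m + n ≤ o
+m≤+o-+n⇒m+n≤o m n o m≤o-n with n ≤? o
... | yes n≤o = m≤o∸n⇒m+n≤o m n≤o (ℤ.drop‿+≤+ (subst (+ m ≤ℤ_) o-n≡o∸n m≤o-n))
  where
  o-n≡o∸n : + o - + n ≡ + (o ∸ n)
  o-n≡o∸n = trans (ℤ.m-n≡m⊖n o n) (ℤ.⊖-≥ n≤o)
... | no n≰o =
  contradiction (+≤-+⇒≡0 (subst (+ m ≤ℤ_) o-n≡-[n∸o] m≤o-n)) (m>n⇒m∸n≢0 (≰⇒> n≰o))
  where
  o-n≡-[n∸o] : + o - + n ≡ - + (n ∸ o)
  o-n≡-[n∸o] = trans (ℤ.m-n≡m⊖n o n) (ℤ.⊖-< (≰⇒> n≰o))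
  +≤-+⇒≡0 : ∀ {r} → + m ≤ℤ - + r → r ≡ 0
  +≤-+⇒≡0 {zero} _ = refl

LastLeℤ⇒lastOr≤ : (xs : Vec ℕ (suc m)) → LastLeℤ xs c′ → + lastOr z xs ≤ℤ c′
LastLeℤ⇒lastOr≤ (x ∷ [])     ≤c = ≤c
LastLeℤ⇒lastOr≤ (x ∷ y ∷ xs) ≤c = LastLeℤ⇒lastOr≤ {z = x} (y ∷ xs) ≤c

lastOr≤⇒LastLeℤ : (xs : Vec ℕ m) → + lastOr z xs ≤ℤ c′ → LastLeℤ xs c′
lastOr≤⇒LastLeℤ []           _  = tt
lastOr≤⇒LastLeℤ (x ∷ [])     ≤c = ≤c
lastOr≤⇒LastLeℤ (x ∷ y ∷ xs) ≤c = lastOr≤⇒LastLeℤ {z = x} (y ∷ xs) ≤c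

LastLeℤ⇒lastOr+≤ : (ys : Vec ℕ m) → d ≤ m → LastLeℤ ys (+ k - + d) → lastOr 0 ys + d ≤ k
LastLeℤ⇒lastOr+≤ []       z≤n _    = z≤n
LastLeℤ⇒lastOr+≤ (y ∷ ys) _   last =
  +m≤+o-+n⇒m+n≤o _ _ _ (LastLeℤ⇒lastOr≤ {z = 0} (y ∷ ys) last)

PFBound⇒positive : (ys : Vec ℕ m) → PFBound p ys → All (1 ≤_) ys
PFBound⇒positive []       _                 = []
PFBound⇒positive (y ∷ ys) ((1≤y , _) , pf) = 1≤y ∷ PFBound⇒positive ys pf

AllFrom : (ℕ → ℕ → Set) → ℕ → Vec ℕ m → Set
AllFrom P p []       = ⊤
AllFrom P p (y ∷ ys) = P p y × AllFrom P (suc p) ys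

AnyFrom : (ℕ → ℕ → Set) → ℕ → Vec ℕ m → Set
AnyFrom P p []       = ⊥
AnyFrom P p (y ∷ ys) = P p y ⊎ AnyFrom P (suc p) ys

AllFrom-map : (∀ {p y} → P p y → Q p y) → (ys : Vec ℕ m) → AllFrom P p ys → AllFrom Q p ys
AllFrom-map g []       _          = tt
AllFrom-map g (y ∷ ys) (py , pys) = g py , AllFrom-map g ys pys

AnyFrom-map : (∀ {p y} → P p y → Q p y) → (ys : Vec ℕ m) → AnyFrom P p ys → AnyFrom Q p ys
AnyFrom-map g (y ∷ ys) (inj₁ py)  = inj₁ (g py)
AnyFrom-map g (y ∷ ys) (inj₂ pys) = inj₂ (AnyFrom-map g ys pys)

AllFrom-AnyFrom-disjoint : (∀ {p y} → P p y → Q p y → ⊥) →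
                           (ys : Vec ℕ m) → AllFrom P p ys → AnyFrom Q p ys → ⊥
AllFrom-AnyFrom-disjoint P∩Q=∅ (y ∷ ys) (py , _)   (inj₁ qy)  = P∩Q=∅ py qy
AllFrom-AnyFrom-disjoint P∩Q=∅ (y ∷ ys) (_  , pys) (inj₂ qys) =
  AllFrom-AnyFrom-disjoint P∩Q=∅ ys pys qys

allFrom? : (∀ p y → Dec (P p y)) → ∀ p (ys : Vec ℕ m) → Dec (AllFrom P p ys)
allFrom? P? p []       = yes tt
allFrom? P? p (y ∷ ys) = P? p y ×-dec allFrom? P? (suc p) ys

¬AllFrom⇒AnyFrom¬ : (∀ p y → Dec (P p y)) → (ys : Vec ℕ m) →
                    ¬ AllFrom P p ys → AnyFrom (λ p y → ¬ P p y) p ys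
¬AllFrom⇒AnyFrom¬         P? []       ¬all = contradiction tt ¬all
¬AllFrom⇒AnyFrom¬ {p = p} P? (y ∷ ys) ¬all with P? p y
... | yes py = inj₂ (¬AllFrom⇒AnyFrom¬ P? ys (¬all ∘ (py ,_)))
... | no ¬py = inj₁ ¬py

-- The depth of an entry y at position p is p ∸ y.
Depth≥ Depth≤ : ℕ → ℕ → ℕ → Set
Depth≥ h p y = y + h ≤ p
Depth≤ h p y = p ≤ y + h

Depth≥-Depth≤-disjoint : Depth≥ (suc h) p v → Depth≤ h p v → ⊥
Depth≥-Depth≤-disjoint {h} {p} {v} deep shallow = <⇒≱ (subst (_≤ p) (+-suc v h) deep) shallow

¬Depth≥⇒Depth≤ : ¬ Depth≥ (suc h) p v → Depth≤ h p v
¬Depth≥⇒Depth≤ {h} {p} {v} ¬deep = ≤-pred (subst (suc p ≤_) (+-suc v h) (≰⇒> ¬deep))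

PFBound⇒Depth≥0 : (ys : Vec ℕ m) → PFBound p ys → AllFrom (Depth≥ 0) p ys
PFBound⇒Depth≥0 []       _                 = tt
PFBound⇒Depth≥0 (y ∷ ys) ((_ , y≤p) , pf) =
  subst (_≤ _) (sym (+-identityʳ y)) y≤p , PFBound⇒Depth≥0 ys pf

NondecreasingFrom⇒AnyDepth≤ : (ys : Vec ℕ m) → 0 < m → NondecreasingFrom p ys →
                              AnyFrom (Depth≤ h) p ys
NondecreasingFrom⇒AnyDepth≤ {h = h} (y ∷ ys) _ (p≤y , _) = inj₁ (≤-trans p≤y (m≤m+n y h))

LastDepth≥ : ℕ → ℕ → Vec ℕ m → Set
LastDepth≥ h p []           = ⊤
LastDepth≥ h p (y ∷ [])     = Depth≥ h p y
LastDepth≥ h p (y ∷ w ∷ ys) = LastDepth≥ h (suc p) (w ∷ ys)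

LastDepth≥-tail : (ys : Vec ℕ m) → LastDepth≥ h p (v ∷ ys) → LastDepth≥ h (suc p) ys
LastDepth≥-tail []       _    = tt
LastDepth≥-tail (w ∷ ys) last = last

AllFrom⇒LastDepth≥ : (ys : Vec ℕ m) → AllFrom (Depth≥ h) p ys → LastDepth≥ h p ys
AllFrom⇒LastDepth≥ []           _          = tt
AllFrom⇒LastDepth≥ (y ∷ [])     (deep , _) = deep
AllFrom⇒LastDepth≥ (y ∷ w ∷ ys) (_ , deep) = AllFrom⇒LastDepth≥ (w ∷ ys) deep

lastOr⇒LastDepth≥ : (ys : Vec ℕ m) → lastOr z ys + h ≤ p + m → LastDepth≥ h (suc p) ys
lastOr⇒LastDepth≥ []           _ = tt
lastOr⇒LastDepth≥ {h = h} {p} (y ∷ [])     y+h≤p+1 = subst (y + h ≤_) (+-comm p 1) y+h≤p+1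
lastOr⇒LastDepth≥ {m = suc m} {h = h} {p} (y ∷ w ∷ ys) last+h≤ =
  lastOr⇒LastDepth≥ {z = y} (w ∷ ys) (subst (lastOr w ys + h ≤_) (+-suc p m) last+h≤)

lastDepth≥ : (ys : Vec ℕ (n + d)) → PFBound 1 ys → lastOr 0 ys + d ≤ suc n → LastDepth≥ d 1 ys
lastDepth≥         {d = zero}  ys pf _          = AllFrom⇒LastDepth≥ ys (PFBound⇒Depth≥0 ys pf)
lastDepth≥ {n = n} {d = suc d} ys _  last+d≤1+n =
  lastOr⇒LastDepth≥ ys
    (≤-trans last+d≤1+n (subst (suc n ≤_) (sym (+-suc n d)) (s≤s (m≤m+n n d))))

Decrement : ℕ → Vec ℕ m → ℕ → Set
Decrement p []       j = ⊥
Decrement p (x ∷ xs) j = (p ≡ j × p ≤ x) ⊎ (x ≤ p × Decrement (suc p) xs j)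

-- InDFrom 1 and InFFrom 1 unfold to InD and InF.
InDFrom : ℕ → Vec ℕ m → ℕ → Set
InDFrom {m} c xs i = Σ (Fin m) λ p → (c + toℕ p ≡ i) × (i ≤ lookup xs p) ×
  ((q : Fin m) → toℕ q < toℕ p → lookup xs q ≤ c + toℕ q)

InDFrom⇒Decrement : (xs : Vec ℕ m) → InDFrom c xs j → Decrement c xs j
InDFrom⇒Decrement {c = c} (x ∷ xs) (zero , refl , j≤x , _) =
  inj₁ (sym (+-identityʳ c) , subst (_≤ x) (+-identityʳ c) j≤x)
InDFrom⇒Decrement {c = c} (x ∷ xs) (suc p , refl , j≤ , earlier) =
  inj₂ (x≤c , InDFrom⇒Decrement xs (p , sym (+-suc c (toℕ p)) , j≤ , earlier′))
  where
  x≤c : x ≤ c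
  x≤c = subst (x ≤_) (+-identityʳ c) (earlier zero z<s)
  earlier′ : (q : Fin _) → toℕ q < toℕ p → lookup xs q ≤ suc c + toℕ q
  earlier′ q q<p = subst (lookup xs q ≤_) (+-suc c (toℕ q)) (earlier (suc q) (s≤s q<p))

Decrement⇒InDFrom : (xs : Vec ℕ m) → Decrement c xs j → InDFrom c xs j
Decrement⇒InDFrom {c = c} (x ∷ xs) (inj₁ (refl , c≤x)) = zero , +-identityʳ c , c≤x , λ _ ()
Decrement⇒InDFrom {c = c} (x ∷ xs) (inj₂ (x≤c , dec)) with Decrement⇒InDFrom xs dec
... | p , refl , j≤ , earlier = suc p , +-suc c (toℕ p) , j≤ , earlier′
  where
  earlier′ : (q : Fin _) → toℕ q < suc (toℕ p) → lookup (x ∷ xs) q ≤ c + toℕ q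
  earlier′ zero    _         = subst (x ≤_) (sym (+-identityʳ c)) x≤c
  earlier′ (suc q) (s≤s q<p) = subst (lookup xs q ≤_) (sym (+-suc c (toℕ q))) (earlier q q<p)

InD⇔Decrement : (xs : Vec ℕ m) → InD xs j ⇔ Decrement 1 xs j
InD⇔Decrement xs = mk⇔ (InDFrom⇒Decrement xs) (Decrement⇒InDFrom xs)

FixedAt : ℕ → ℕ → ℕ → Set
FixedAt j p y = p ≡ j × y ≡ j

InFFrom : ℕ → Vec ℕ m → ℕ → Set
InFFrom {m} c ys j = Σ (Fin m) λ p → (c + toℕ p ≡ j) × (lookup ys p ≡ j)

InFFrom⇒AnyFrom : (ys : Vec ℕ m) → InFFrom c ys j → AnyFrom (FixedAt j) c ys
InFFrom⇒AnyFrom {c = c} (y ∷ ys) (zero  , refl , y≡j) = inj₁ (sym (+-identityʳ c) , y≡j)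
InFFrom⇒AnyFrom {c = c} (y ∷ ys) (suc p , refl , y≡j) =
  inj₂ (InFFrom⇒AnyFrom ys (p , sym (+-suc c (toℕ p)) , y≡j))

AnyFrom⇒InFFrom : (ys : Vec ℕ m) → AnyFrom (FixedAt j) c ys → InFFrom c ys j
AnyFrom⇒InFFrom {c = c} (y ∷ ys) (inj₁ (refl , y≡c)) = zero , +-identityʳ c , y≡c
AnyFrom⇒InFFrom {c = c} (y ∷ ys) (inj₂ fixed) with AnyFrom⇒InFFrom ys fixed
... | p , refl , y≡j = suc p , +-suc c (toℕ p) , y≡j

InF⇔AnyFixed : (ys : Vec ℕ m) → InF ys j ⇔ AnyFrom (FixedAt j) 1 ys
InF⇔AnyFixed ys = mk⇔ (InFFrom⇒AnyFrom ys) (AnyFrom⇒InFFrom ys)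

-- Parking with nondecreasing preferences

-- defect n prefs unfolds to spotsAbove n (parkedSpots prefs).
spotsAbove : ℕ → List ℕ → ℕ
spotsAbove n occ = length (filterᵇ (n <ᵇ_) occ)

spotsAbove-∷-> : (occ : List ℕ) → n < t → spotsAbove n (t ∷ occ) ≡ suc (spotsAbove n occ)
spotsAbove-∷-> {n} {t} occ n<t with n <ᵇ t | <⇒<ᵇ n<t
... | true | _ = refl

spotsAbove-∷-≤ : (occ : List ℕ) → t ≤ n → spotsAbove n (t ∷ occ) ≡ spotsAbove n occ
spotsAbove-∷-≤ {t} {n} occ t≤n with n <ᵇ t in n<ᵇt
... | false = refl
... | true  = contradiction (<ᵇ⇒< n t (subst T (sym n<ᵇt) tt)) (≤⇒≯ t≤n)

spotsAbove-∷⊔ : (occ : List ℕ) → a ≤ suc n → spotsAbove n occ ≡ t ∸ suc n →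
                spotsAbove n (a ⊔ t ∷ occ) ≡ a ⊔ t ∸ n
spotsAbove-∷⊔ {a} {n} {t} occ a≤1+n above with n <? a ⊔ t
... | no n≮a⊔t = begin
  spotsAbove n (a ⊔ t ∷ occ) ≡⟨ spotsAbove-∷-≤ occ a⊔t≤n ⟩
  spotsAbove n occ           ≡⟨ above ⟩
  t ∸ suc n                  ≡⟨ m≤n⇒m∸n≡0 (m≤n⇒m≤1+n (m⊔n≤o⇒n≤o a t a⊔t≤n)) ⟩
  0                          ≡⟨ m≤n⇒m∸n≡0 a⊔t≤n ⟨
  a ⊔ t ∸ n                  ∎
  where
  open ≡-Reasoning
  a⊔t≤n : a ⊔ t ≤ n
  a⊔t≤n = ≮⇒≥ n≮a⊔t
... | yes n<a⊔t with n <? t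
...   | yes n<t = begin
  spotsAbove n (a ⊔ t ∷ occ) ≡⟨ spotsAbove-∷-> occ n<a⊔t ⟩
  suc (spotsAbove n occ)     ≡⟨ cong suc above ⟩
  suc (t ∸ suc n)            ≡⟨ +-∸-assoc 1 n<t ⟨
  t ∸ n                      ≡⟨ cong (_∸ n) (m≤n⇒m⊔n≡n (≤-trans a≤1+n n<t)) ⟨
  a ⊔ t ∸ n                  ∎
  where open ≡-Reasoning
...   | no n≮t = begin
  spotsAbove n (a ⊔ t ∷ occ) ≡⟨ spotsAbove-∷-> occ n<a⊔t ⟩
  suc (spotsAbove n occ)     ≡⟨ cong suc above ⟩
  suc (t ∸ suc n)            ≡⟨ cong suc (m≤n⇒m∸n≡0 (m≤n⇒m≤1+n t≤n)) ⟩
  1                          ≡⟨ m+n∸n≡m 1 n ⟨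
  suc n ∸ n                  ≡⟨ cong (_∸ n) a⊔t≡1+n ⟨
  a ⊔ t ∸ n                  ∎
  where
  open ≡-Reasoning
  t≤n : t ≤ n
  t≤n = ≮⇒≥ n≮t
  a⊔t≡1+n : a ⊔ t ≡ suc n
  a⊔t≡1+n = ≤-antisym (⊔-lub a≤1+n (m≤n⇒m≤1+n t≤n)) n<a⊔t

firstFreeFuel≡⊔ : ∀ fuel occ → List.All (_< t) occ → (∀ b → c ≤ b → b < t → b ∈ occ) →
                  t ≤ c + fuel → firstFreeFuel fuel occ c ≡ c ⊔ t
firstFreeFuel≡⊔ {t} {c} zero occ _ _ t≤c+0 =
  sym (m≥n⇒m⊔n≡m (subst (t ≤_) (+-identityʳ c) t≤c+0))
firstFreeFuel≡⊔ {t} {c} (suc fuel) occ below filled t≤ with c ∈? occ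
... | yes c∈occ = begin
  firstFreeFuel fuel occ (suc c) ≡⟨ firstFreeFuel≡⊔ fuel occ below (λ b → filled b ∘ <⇒≤) t≤′ ⟩
  suc c ⊔ t                     ≡⟨ m≤n⇒m⊔n≡n c<t ⟩
  t                             ≡⟨ m≤n⇒m⊔n≡n (<⇒≤ c<t) ⟨
  c ⊔ t                         ∎
  where
  open ≡-Reasoning
  c<t : c < t
  c<t = List.lookup below c∈occ
  t≤′ : t ≤ suc c + fuel
  t≤′ = subst (t ≤_) (+-suc c fuel) t≤
... | no c∉occ = sym (m≥n⇒m⊔n≡m (≮⇒≥ (c∉occ ∘ filled c ≤-refl)))

-- room makes the fuel of firstFree sufficient.
record Parked (n : ℕ) (occ : List ℕ) (t lo : ℕ) : Set where
  field
    below  : List.All (_< t) occ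
    filled : ∀ b → lo ≤ b → b < t → b ∈ occ
    room   : t ≤ lo + length occ
    above  : spotsAbove n occ ≡ t ∸ suc n

firstFree-Parked : Parked n occ t lo → lo ≤ a → firstFree occ a ≡ a ⊔ t
firstFree-Parked {occ = occ} st lo≤a =
  firstFreeFuel≡⊔ (suc (length occ)) occ below (λ b → filled b ∘ ≤-trans lo≤a)
                  (≤-trans room (+-mono-≤ lo≤a (n≤1+n _)))
  where open Parked st

Parked-∷ : Parked n occ t lo → lo ≤ a → a ≤ suc n → Parked n (a ⊔ t ∷ occ) (suc (a ⊔ t)) a
Parked-∷ {n} {occ} {t} {lo} {a} st lo≤a a≤1+n = record
  { below  = ≤-refl List.∷ List.map (λ b<t → ≤-trans b<t (m≤n⇒m≤1+n (m≤n⊔m a t))) below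
  ; filled = filled′
  ; room   = ⊔-lub (m<m+n a z<s) (subst (suc t ≤_) (sym (+-suc a (length occ)))
                                       (s≤s (≤-trans room (+-monoˡ-≤ (length occ) lo≤a))))
  ; above  = spotsAbove-∷⊔ occ a≤1+n above
  }
  where
  open Parked st

  <a⊔t⇒<t : ∀ {b} → a ≤ b → b < a ⊔ t → b < t
  <a⊔t⇒<t a≤b b<a⊔t with ⊔-sel a t
  ... | inj₁ a⊔t≡a = contradiction (subst (_ <_) a⊔t≡a b<a⊔t) (≤⇒≯ a≤b)
  ... | inj₂ a⊔t≡t = subst (_ <_) a⊔t≡t b<a⊔t

  filled′ : ∀ b → a ≤ b → b < suc (a ⊔ t) → b ∈ a ⊔ t ∷ occ
  filled′ b a≤b b≤a⊔t with b ≟ a ⊔ t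
  ... | yes b≡a⊔t = here b≡a⊔t
  ... | no  b≢a⊔t =
    there (filled b (≤-trans lo≤a a≤b) (<a⊔t⇒<t a≤b (≤∧≢⇒< (≤-pred b≤a⊔t) b≢a⊔t)))

nextSpot : ℕ → Vec ℕ m → ℕ
nextSpot t []       = t
nextSpot t (a ∷ xs) = nextSpot (suc (a ⊔ t)) xs

parkFrom-Parked : (xs : Vec ℕ m) → Parked n occ t lo → NondecreasingFrom lo xs → All (_≤ suc n) xs →
                  Parked n (parkFrom occ (toList xs)) (nextSpot t xs) (lastOr lo xs)
parkFrom-Parked []       st _                _                = st
parkFrom-Parked (a ∷ xs) st (lo≤a , sorted) (a≤1+n ∷ bounds) rewrite firstFree-Parked st lo≤a =
  parkFrom-Parked xs (Parked-∷ st lo≤a a≤1+n) sorted bounds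

defect≡nextSpot∸ : (xs : Vec ℕ n) → NondecreasingFrom 1 xs → All (_≤ suc n) xs →
                   defect n (toList xs) ≡ nextSpot 1 xs ∸ suc n
defect≡nextSpot∸ {n} xs sorted bounds = Parked.above (parkFrom-Parked xs empty sorted bounds)
  where
  empty : Parked n [] 1 1
  empty = record
    { below  = List.[]
    ; filled = λ b 1≤b b<1 → contradiction b<1 (≤⇒≯ 1≤b)
    ; room   = ≤-refl
    ; above  = sym (0∸n≡0 n)
    }

-- Rho i f d xs ys: xs starts with x_i, f entries have been inserted so far, so ys starts
-- at position i + f, and d insertions are made in total.
data Rho : ℕ → ℕ → ℕ → Vec ℕ m → Vec ℕ m′ → Set where
  done   : Rho i d d [] []
  keep   : a ≡ v + f → a ≤ i + f → 0 < v → Rho (suc i) f d xs ys → Rho i f d (a ∷ xs) (v ∷ ys)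
  insert : i + f < a → Rho i (suc f) d (a ∷ xs) ys → Rho i f d (a ∷ xs) (i ∷ ys)

Rho-f≤d : Rho i f d xs ys → f ≤ d
Rho-f≤d done           = ≤-refl
Rho-f≤d (keep _ _ _ r) = Rho-f≤d r
Rho-f≤d (insert _ r)   = <⇒≤ (Rho-f≤d r)

Rho-length : {xs : Vec ℕ m} {ys : Vec ℕ m′} → Rho i f d xs ys → m′ + f ≡ m + d
Rho-length done           = refl
Rho-length (keep _ _ _ r) = cong suc (Rho-length r)
Rho-length {m′ = suc m′} {f = f} (insert _ r) = trans (sym (+-suc m′ f)) (Rho-length r)

Rho-lastOr : Rho i f d xs ys → lastOr (z + f) xs ≡ lastOr z ys + d
Rho-lastOr done              = refl
Rho-lastOr (keep refl _ _ r) = Rho-lastOr r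
Rho-lastOr {i = i} (insert _ r) = Rho-lastOr {z = i} r

Rho-nextSpot : {xs : Vec ℕ m} → Rho i f d xs ys → nextSpot (i + f) xs ≡ i + m + d
Rho-nextSpot {i = i} {d = d} done = cong (_+ d) (sym (+-identityʳ i))
Rho-nextSpot {m = suc m} {i = i} {f} {d} (keep {a = a} {xs = xs} _ a≤i+f _ r) = begin
  nextSpot (suc (a ⊔ (i + f))) xs ≡⟨ cong (λ s → nextSpot (suc s) xs) (m≤n⇒m⊔n≡n a≤i+f) ⟩
  nextSpot (suc i + f) xs         ≡⟨ Rho-nextSpot r ⟩
  suc i + m + d                   ≡⟨ cong (_+ d) (+-suc i m) ⟨
  i + suc m + d                   ∎
  where open ≡-Reasoning
Rho-nextSpot {i = i} {f} (insert {a = a} {xs = xs} i+f<a r) = begin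
  nextSpot (suc (a ⊔ (i + f))) xs     ≡⟨ cong (λ s → nextSpot (suc s) xs) a⊔≡a⊔ ⟩
  nextSpot (suc (a ⊔ (i + suc f))) xs ≡⟨ Rho-nextSpot r ⟩
  _                                   ∎
  where
  open ≡-Reasoning
  a⊔≡a⊔ : a ⊔ (i + f) ≡ a ⊔ (i + suc f)
  a⊔≡a⊔ = trans (m≥n⇒m⊔n≡m (<⇒≤ i+f<a))
                (sym (m≥n⇒m⊔n≡m (subst (_≤ a) (sym (+-suc i f)) i+f<a)))

Rho-positive : Rho i f d xs ys → All (f <_) xs
Rho-positive done                        = []
Rho-positive {f = f} (keep refl _ 0<v r) = +-monoˡ-< f 0<v ∷ Rho-positive r
Rho-positive (insert _ r)                = All.map <⇒≤ (Rho-positive r)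

Rho-depth : Rho i f d xs ys → AllFrom (Depth≥ f) (i + f) ys
Rho-depth done                = tt
Rho-depth (keep refl le _ r)  = le , Rho-depth r
Rho-depth {i = i} {f = f} {ys = _ ∷ ys} (insert _ r) =
  ≤-refl , subst (λ p → AllFrom (Depth≥ f) p ys) (+-suc i f)
                 (AllFrom-map (λ {_} {y} → ≤-trans (+-monoʳ-≤ y (n≤1+n f))) ys (Rho-depth r))

Rho-reaches : Rho i f d xs ys → f < d → AnyFrom (Depth≤ f) (i + f) ys
Rho-reaches done           f<f = contradiction f<f (<-irrefl refl)
Rho-reaches (keep _ _ _ r) f<d = inj₂ (Rho-reaches r f<d)
Rho-reaches (insert _ _)   _   = inj₁ ≤-refl

Rho-parking : Rho i f d xs ys → 0 < i → PFBound (i + f) ys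
Rho-parking done _ = tt
Rho-parking {f = f} (keep {v = v} refl v+f≤i+f 0<v r) _ =
  (0<v , ≤-trans (m≤m+n v f) v+f≤i+f) , Rho-parking r z<s
Rho-parking {i = i} {f} {ys = _ ∷ ys} (insert _ r) 0<i =
  (0<i , m≤m+n i f) , subst (λ p → PFBound p ys) (+-suc i f) (Rho-parking r 0<i)

Rho-sorted→ : Rho i f d xs ys → b ≤ i → NondecreasingFrom (b + f) xs → NondecreasingFrom b ys
Rho-sorted→ done _ _ = tt
Rho-sorted→ {f = f} {b = b} (keep {v = v} refl v+f≤i+f _ r) b≤i (b+f≤v+f , sorted) =
  +-cancelʳ-≤ f b v b+f≤v+f , Rho-sorted→ r (m≤n⇒m≤1+n (+-cancelʳ-≤ f v _ v+f≤i+f)) sorted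
Rho-sorted→ {i = i} {f} (insert {a = a} i+f<a r) b≤i (_ , sorted) =
  b≤i , Rho-sorted→ r ≤-refl (subst (_≤ a) (sym (+-suc i f)) i+f<a , sorted)

Rho-sorted← : Rho i f d xs ys → NondecreasingFrom b ys → NondecreasingFrom (b + f) xs
Rho-sorted← done _ = tt
Rho-sorted← {f = f} (keep refl _ _ r) (b≤v , sorted) = +-monoˡ-≤ f b≤v , Rho-sorted← r sorted
Rho-sorted← {f = f} (insert i+f<a r) (b≤i , sorted) =
  ≤-trans (+-monoˡ-≤ f b≤i) (<⇒≤ i+f<a) , proj₂ (Rho-sorted← r sorted)

Rho⇒defect : (xs : Vec ℕ n) → Rho 1 0 d xs ys → NondecreasingFrom 1 xs → All (_≤ suc n) xs →
             defect n (toList xs) ≡ d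
Rho⇒defect {n} {d} xs r sorted bounds = begin
  defect n (toList xs)  ≡⟨ defect≡nextSpot∸ xs sorted bounds ⟩
  nextSpot 1 xs ∸ suc n ≡⟨ cong (_∸ suc n) (Rho-nextSpot r) ⟩
  suc n + d ∸ suc n     ≡⟨ m+n∸m≡n (suc n) d ⟩
  d                     ∎
  where open ≡-Reasoning

Rho-Decrement⇔AnyFixed : Rho i 0 d xs ys → Decrement i xs j ⇔ AnyFrom (FixedAt j) i ys
Rho-Decrement⇔AnyFixed done = mk⇔ (λ ()) (λ ())
Rho-Decrement⇔AnyFixed {i = i} {j = j} (keep {a = a} {v = v} a≡v+0 a≤i+0 _ r) = mk⇔ to from
  where
  a≡v : a ≡ v
  a≡v = trans a≡v+0 (+-identityʳ v)
  a≤i : a ≤ i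
  a≤i = subst (a ≤_) (+-identityʳ i) a≤i+0
  to : Decrement i (a ∷ _) j → AnyFrom (FixedAt j) i (v ∷ _)
  to (inj₁ (refl , i≤a)) = inj₁ (refl , trans (sym a≡v) (≤-antisym a≤i i≤a))
  to (inj₂ (_ , later))  = inj₂ (Equivalence.to (Rho-Decrement⇔AnyFixed r) later)
  from : AnyFrom (FixedAt j) i (v ∷ _) → Decrement i (a ∷ _) j
  from (inj₁ (refl , v≡i)) = inj₁ (refl , ≤-reflexive (sym (trans a≡v v≡i)))
  from (inj₂ later)        = inj₂ (a≤i , Equivalence.from (Rho-Decrement⇔AnyFixed r) later)
Rho-Decrement⇔AnyFixed {i = i} {j = j} (insert {a = a} {ys = ys} i+0<a r) = mk⇔ to from
  where
  i<a : i < a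
  i<a = subst (_< a) (+-identityʳ i) i+0<a
  to : Decrement i (a ∷ _) j → AnyFrom (FixedAt j) i (i ∷ ys)
  to (inj₁ (refl , _)) = inj₁ (refl , refl)
  to (inj₂ (a≤i , _))  = contradiction a≤i (<⇒≱ i<a)
  from : AnyFrom (FixedAt j) i (i ∷ ys) → Decrement i (a ∷ _) j
  from (inj₁ (refl , _)) = inj₁ (refl , <⇒≤ i<a)
  from (inj₂ fixed)      = ⊥-elim (AllFrom-AnyFrom-disjoint below-diagonal ys
                             (subst (λ p → AllFrom (Depth≥ 1) p ys) (+-comm i 1) (Rho-depth r)) fixed)
    where
    below-diagonal : Depth≥ 1 p v → FixedAt j p v → ⊥
    below-diagonal v+1≤p (refl , refl) = contradiction v+1≤p (m+1+n≰m _)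

Rho⇒InD⇔InF : Rho 1 0 d xs ys → InD xs j ⇔ InF ys j
Rho⇒InD⇔InF {xs = xs} {ys = ys} r =
  ⇔.trans (InD⇔Decrement xs) (⇔.trans (Rho-Decrement⇔AnyFixed r) (⇔.sym (InF⇔AnyFixed ys)))

insert-excludes-keep : Rho i (suc f) d xs ys → Rho (suc i) f d xs′ ys → ⊥
insert-excludes-keep {i} {f} {ys = ys} r r′ =
  AllFrom-AnyFrom-disjoint Depth≥-Depth≤-disjoint ys
    (subst (λ p → AllFrom (Depth≥ (suc f)) p ys) (+-suc i f) (Rho-depth r))
    (Rho-reaches r′ (Rho-f≤d r))

Rho-injective : {xs xs′ : Vec ℕ m} → Rho i f d xs ys → Rho i f d xs′ ys → xs ≡ xs′
Rho-injective done           done             = refl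
Rho-injective (keep e _ _ r) (keep e′ _ _ r′) = cong₂ _∷_ (trans e (sym e′)) (Rho-injective r r′)
Rho-injective (insert _ r)   (insert _ r′)    = Rho-injective r r′
Rho-injective (keep _ _ _ r) (insert _ r′)    = ⊥-elim (insert-excludes-keep r′ r)
Rho-injective (insert _ r)   (keep _ _ _ r′)  = ⊥-elim (insert-excludes-keep r r′)

Rho-functional : {ys ys′ : Vec ℕ m′} → Rho i f d xs ys → Rho i f d xs ys′ → ys ≡ ys′
Rho-functional done done = refl
Rho-functional {f = f} (keep {v = v} e _ _ r) (keep {v = v′} e′ _ _ r′) =
  cong₂ _∷_ (+-cancelʳ-≡ f v v′ (trans (sym e) e′)) (Rho-functional r r′)
Rho-functional (insert _ r)       (insert _ r′)       = cong (_ ∷_) (Rho-functional r r′)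
Rho-functional (keep _ a≤i+f _ _) (insert i+f<a _)    = contradiction a≤i+f (<⇒≱ i+f<a)
Rho-functional (insert i+f<a _)   (keep _ a≤i+f _ _)  = contradiction a≤i+f (<⇒≱ i+f<a)

Rho-image : (xs : Vec ℕ m) → 0 < i → f < b → NondecreasingFrom b xs →
            ∃[ d ] ∃[ m′ ] Σ (Vec ℕ m′) (Rho i f d xs)
Rho-image-∷ : ∀ gap → a ≤ i + f + gap → 0 < i → f < a → NondecreasingFrom a xs →
              ∃[ d ] ∃[ m′ ] Σ (Vec ℕ m′) (Rho i f d (a ∷ xs))

Rho-image {f = f}     []       _   _   _              = f , 0 , [] , done
Rho-image {i = i} {f} (a ∷ xs) 0<i f<b (b≤a , sorted) =
  Rho-image-∷ a (m≤n+m a (i + f)) 0<i (<-≤-trans f<b b≤a) sorted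

Rho-image-∷ {a} {i} {f} {xs = xs} gap a≤i+f+gap 0<i f<a sorted with a ≤? i + f
... | yes a≤i+f =
  let d , m′ , ys , r = Rho-image xs z<s f<a sorted
  in  d , suc m′ , a ∸ f ∷ ys , keep (sym (m∸n+n≡m (<⇒≤ f<a))) a≤i+f (m<n⇒0<n∸m f<a) r
... | no a≰i+f with gap
...   | zero    = contradiction (subst (a ≤_) (+-identityʳ (i + f)) a≤i+f+gap) a≰i+f
...   | suc gap =
  let d , m′ , ys , r = Rho-image-∷ gap a≤i+1+f+gap 0<i 1+f<a sorted
  in  d , suc m′ , i ∷ ys , insert (≰⇒> a≰i+f) r
  where
  a≤i+1+f+gap : a ≤ i + suc f + gap
  a≤i+1+f+gap = subst (a ≤_) (trans (+-suc (i + f) gap) (cong (_+ gap) (sym (+-suc i f)))) a≤i+f+gap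
  1+f<a : suc f < a
  1+f<a = ≤-trans (s≤s (+-monoˡ-≤ f 0<i)) (≰⇒> a≰i+f)

Rho-insert : Rho i (suc f) d xs (w ∷ ys) → i ≤ w → Rho i f d xs (i ∷ w ∷ ys)
Rho-insert {i} {f} {w = w} r@(keep refl _ _ _) i≤w =
  insert (subst (_≤ w + suc f) (+-suc i f) (+-monoˡ-≤ (suc f) i≤w)) r
Rho-insert {i} {f} r@(insert {a = a} i+1+f<a _) _ =
  insert (<⇒≤ (subst (_< a) (+-suc i f) i+1+f<a)) r

-- An entry is taken as inserted exactly when it equals i, insertions are still owed and
-- every later entry is deeper than f; LastDepth≥ excludes this for the last entry.
Rho-preimage : (ys : Vec ℕ m′) → 0 < b → NondecreasingFrom b ys →
               AllFrom (Depth≥ f) (i + f) ys → LastDepth≥ d (i + f) ys →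
               f ≤ d → (f < d → AnyFrom (Depth≤ f) (i + f) ys) →
               ∃[ m ] Σ (Vec ℕ m) λ xs → Rho i f d xs ys
Rho-preimage [] _ _ _ _ f≤d reaches with m≤n⇒m<n∨m≡n f≤d
... | inj₁ f<d  = ⊥-elim (reaches f<d)
... | inj₂ refl = 0 , [] , done
Rho-preimage {f = f} {i = i} {d = d} (v ∷ ys) 0<b (b≤v , sorted) (v+f≤i+f , deep) last f≤d reaches
  with v ≟ i ×-dec f <? d ×-dec allFrom? (λ p y → y + suc f ≤? p) (suc (i + f)) ys
... | yes (refl , f<d , deeper) = insertion ys sorted deeper last f<d
  where
  i+1+f≡ : suc (i + f) ≡ i + suc f
  i+1+f≡ = sym (+-suc i f)
  insertion : (ys : Vec ℕ m′) → NondecreasingFrom i ys →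
              AllFrom (Depth≥ (suc f)) (suc (i + f)) ys → LastDepth≥ d (i + f) (i ∷ ys) → f < d →
              ∃[ m ] Σ (Vec ℕ m) λ xs → Rho i f d xs (i ∷ ys)
  insertion []       _              _      i+d≤i+f f<d =
    contradiction (+-cancelˡ-≤ i d f i+d≤i+f) (<⇒≱ f<d)
  insertion (w ∷ ys) (i≤w , sorted) deeper last f<d =
    let m , xs , r = Rho-preimage (w ∷ ys) (<-≤-trans 0<b b≤v) (i≤w , sorted)
                       (subst (λ p → AllFrom (Depth≥ (suc f)) p (w ∷ ys)) i+1+f≡ deeper)
                       (subst (λ p → LastDepth≥ d p (w ∷ ys)) i+1+f≡ last)
                       f<d (λ _ → inj₁ (+-monoˡ-≤ (suc f) i≤w))
    in  m , xs , Rho-insert r i≤w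
... | no ¬insertion =
  let m , xs , r = Rho-preimage ys 0<v sorted deep (LastDepth≥-tail ys last) f≤d reaches′
  in  suc m , v + f ∷ xs , keep refl v+f≤i+f 0<v r
  where
  0<v : 0 < v
  0<v = <-≤-trans 0<b b≤v
  reaches′ : f < d → AnyFrom (Depth≤ f) (suc (i + f)) ys
  reaches′ f<d with reaches f<d
  ... | inj₂ later = later
  ... | inj₁ i+f≤v+f =
    AnyFrom-map ¬Depth≥⇒Depth≤ ys
      (¬AllFrom⇒AnyFrom¬ (λ p y → y + suc f ≤? p) ys
        (λ deeper → ¬insertion (+-cancelʳ-≡ f v i (≤-antisym v+f≤i+f i+f≤v+f) , f<d , deeper)))

×-irrelevant : {A B : Set} → Irrelevant A → Irrelevant B → Irrelevant (A × B)
×-irrelevant irrA irrB (a , b) (a′ , b′) = cong₂ _,_ (irrA a a′) (irrB b b′)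

Σ-≡-irrelevant : {A : Set} {B : A → Set} → (∀ {a} → Irrelevant (B a)) →
                 {p q : Σ A B} → proj₁ p ≡ proj₁ q → p ≡ q
Σ-≡-irrelevant irr {a , b} {.a , b′} refl = cong (a ,_) (irr b b′)

graph⇒bijection : {A B : Set} (R : A → B → Set) →
                  ((a : A) → Σ B (R a)) → ((b : B) → Σ A λ a → R a b) →
                  (∀ {a a′ b} → R a b → R a′ b → a ≡ a′) →
                  (∀ {a b b′} → R a b → R a b′ → b ≡ b′) →
                  Σ (A ⤖ B) λ ρ → (a : A) → R a (Bijection.to ρ a)
graph⇒bijection R image preimage injective functional =
  mk⤖ (image-injective , image-surjective) , proj₂ ∘ image
  where
  image-injective : ∀ {a a′} → proj₁ (image a) ≡ proj₁ (image a′) → a ≡ a′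
  image-injective {a} {a′} eq =
    injective (proj₂ (image a)) (subst (R a′) (sym eq) (proj₂ (image a′)))
  image-surjective : ∀ b → Σ _ λ a → ∀ {a′} → a′ ≡ a → proj₁ (image a′) ≡ b
  image-surjective b =
    proj₁ (preimage b) , λ { refl → functional (proj₂ (image _)) (proj₂ (preimage b)) }

Nondecreasing-irrelevant : (xs : Vec ℕ m) → Irrelevant (Nondecreasing xs)
Nondecreasing-irrelevant []           _ _ = refl
Nondecreasing-irrelevant (x ∷ [])     _ _ = refl
Nondecreasing-irrelevant (x ∷ y ∷ xs) =
  ×-irrelevant ≤-irrelevant (Nondecreasing-irrelevant (y ∷ xs))

LastLe-irrelevant : (xs : Vec ℕ m) → Irrelevant (LastLe xs k)
LastLe-irrelevant []           _ _ = refl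
LastLe-irrelevant (x ∷ [])     = ≤-irrelevant
LastLe-irrelevant (x ∷ y ∷ xs) = LastLe-irrelevant (y ∷ xs)

LastLeℤ-irrelevant : (xs : Vec ℕ m) → Irrelevant (LastLeℤ xs c′)
LastLeℤ-irrelevant []           _ _ = refl
LastLeℤ-irrelevant (x ∷ [])     = ℤ.≤-irrelevant
LastLeℤ-irrelevant (x ∷ y ∷ xs) = LastLeℤ-irrelevant (y ∷ xs)

PFBound-irrelevant : (ys : Vec ℕ m) → Irrelevant (PFBound p ys)
PFBound-irrelevant []       _ _ = refl
PFBound-irrelevant (y ∷ ys) =
  ×-irrelevant (×-irrelevant ≤-irrelevant ≤-irrelevant) (PFBound-irrelevant ys)

DPF↑≤ : ℕ → ℕ → ℕ → Set
DPF↑≤ n d k = Σ (Vec ℕ n) λ xs → IsDPFup n d xs × LastLe xs k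

PF↑≤ : ℕ → ℕ → ℕ → Set
PF↑≤ n d k = Σ (Vec ℕ (n + d)) λ ys → IsPFup (n + d) ys × LastLeℤ ys (+ k - + d)

DPF↑≤-irrelevant : (xs : Vec ℕ n) → Irrelevant (IsDPFup n d xs × LastLe xs k)
DPF↑≤-irrelevant xs =
  ×-irrelevant (×-irrelevant (All.irrelevant (×-irrelevant ≤-irrelevant ≤-irrelevant))
                             (×-irrelevant (Nondecreasing-irrelevant xs) ≡-irrelevant))
               (LastLe-irrelevant xs)

PF↑≤-irrelevant : (ys : Vec ℕ m) → Irrelevant (IsPFup m ys × LastLeℤ ys c′)
PF↑≤-irrelevant ys =
  ×-irrelevant (×-irrelevant (Nondecreasing-irrelevant ys) (PFBound-irrelevant ys))
               (LastLeℤ-irrelevant ys)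

ρ-image : (xs : Vec ℕ n) → NondecreasingFrom 1 xs → All (_≤ suc n) xs →
          defect n (toList xs) ≡ d → Σ (Vec ℕ (n + d)) (Rho 1 0 d xs)
ρ-image xs sorted bounds defect≡d with Rho-image xs z<s z<s sorted
... | d′ , m′ , ys , r with trans (sym (Rho⇒defect xs r sorted bounds)) defect≡d
...   | refl =
  subst (λ m → Σ (Vec ℕ m) (Rho 1 0 d′ xs)) (trans (sym (+-identityʳ m′)) (Rho-length r)) (ys , r)

ρ-preimage : (ys : Vec ℕ (n + d)) → NondecreasingFrom 1 ys → PFBound 1 ys → LastDepth≥ d 1 ys →
             Σ (Vec ℕ n) λ xs → Rho 1 0 d xs ys
ρ-preimage {n} {d} ys sorted pf last
  with Rho-preimage ys z<s sorted (PFBound⇒Depth≥0 ys pf) last z≤n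
         (λ 0<d → NondecreasingFrom⇒AnyDepth≤ ys (≤-trans 0<d (m≤n+m d n)) sorted)
... | m , xs , r = subst (λ m → Σ (Vec ℕ m) λ xs → Rho 1 0 d xs ys) m≡n (xs , r)
  where
  m≡n : m ≡ n
  m≡n = +-cancelʳ-≡ d m n (trans (sym (Rho-length r)) (+-identityʳ (n + d)))

toPF : (x : DPF↑≤ n d k) → Σ (PF↑≤ n d k) λ y → Rho 1 0 d (proj₁ x) (proj₁ y)
toPF {n} {d} {k} (x , (bounds , sorted , defect≡d) , x≤k) =
  (y , (y-sorted , Rho-parking r z<s) , y≤k-d) , r
  where
  x-sorted : NondecreasingFrom 1 x
  x-sorted = Nondecreasing⇒From x (All.map proj₁ bounds) sorted
  image : Σ (Vec ℕ (n + d)) (Rho 1 0 d x)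
  image = ρ-image x x-sorted (All.map proj₂ bounds) defect≡d
  y : Vec ℕ (n + d)
  y = proj₁ image
  r : Rho 1 0 d x y
  r = proj₂ image
  y-sorted : Nondecreasing y
  y-sorted = From⇒Nondecreasing y (Rho-sorted→ r ≤-refl x-sorted)
  y≤k-d : LastLeℤ y (+ k - + d)
  y≤k-d = lastOr≤⇒LastLeℤ {z = 0} y
    (m+n≤o⇒+m≤+o-+n _ d k (subst (_≤ k) (Rho-lastOr r) (LastLe⇒lastOr≤ x z≤n x≤k)))

toDPF : k ≤ suc n → (y : PF↑≤ n d k) → Σ (DPF↑≤ n d k) λ x → Rho 1 0 d (proj₁ x) (proj₁ y)
toDPF {k} {n} {d} k≤1+n (y , (sorted , pf) , y≤k-d) =
  (x , (bounds , From⇒Nondecreasing x x-sorted , Rho⇒defect x r x-sorted (All.map proj₂ bounds)) , x≤k)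
  , r
  where
  y+d≤k : lastOr 0 y + d ≤ k
  y+d≤k = LastLeℤ⇒lastOr+≤ y (m≤n+m d n) y≤k-d
  y-sorted : NondecreasingFrom 1 y
  y-sorted = Nondecreasing⇒From y (PFBound⇒positive y pf) sorted
  preimage : Σ (Vec ℕ n) λ x → Rho 1 0 d x y
  preimage = ρ-preimage y y-sorted pf (lastDepth≥ y pf (≤-trans y+d≤k k≤1+n))
  x : Vec ℕ n
  x = proj₁ preimage
  r : Rho 1 0 d x y
  r = proj₂ preimage
  x-sorted : NondecreasingFrom 1 x
  x-sorted = Rho-sorted← r y-sorted
  x≤k : LastLe x k
  x≤k = lastOr≤⇒LastLe {z = 0} x (subst (_≤ k) (sym (Rho-lastOr r)) y+d≤k)
  bounds : All (λ a → 1 ≤ a × a ≤ suc n) x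
  bounds = All.zip (Rho-positive r ,
                    All.map (λ a≤k → ≤-trans a≤k k≤1+n) (NondecreasingFrom⇒All≤ x x-sorted x≤k))

theorem4p13 : (n d k : ℕ) → 1 ≤ k → k ≤ suc n →
    Σ ((Σ (Vec ℕ n) λ x → IsDPFup n d x × LastLe x k)
        ⤖ (Σ (Vec ℕ (n + d)) λ y → IsPFup (n + d) y × LastLeℤ y (+ k - + d)))
      λ ρ → (x : Σ (Vec ℕ n) λ x → IsDPFup n d x × LastLe x k) → (i : ℕ) →
        InD (proj₁ x) i ⇔ InF (proj₁ (Bijection.to ρ x)) i
theorem4p13 n d k _ k≤1+n = proj₁ bijection , λ x i → Rho⇒InD⇔InF (proj₂ bijection x)
  where
  bijection : Σ (DPF↑≤ n d k ⤖ PF↑≤ n d k) λ ρ →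
                (x : DPF↑≤ n d k) → Rho 1 0 d (proj₁ x) (proj₁ (Bijection.to ρ x))
  bijection = graph⇒bijection (λ x y → Rho 1 0 d (proj₁ x) (proj₁ y)) toPF (toDPF k≤1+n)
    (λ r r′ → Σ-≡-irrelevant (DPF↑≤-irrelevant _) (Rho-injective r r′))
    (λ r r′ → Σ-≡-irrelevant (PF↑≤-irrelevant _) (Rho-functional r r′))
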